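{- Let $A\in M_m(\mathbb{Q})$ and $B\in M_n(\mathbb{Q})$. Suppose $\mathcal{D}_A\subset\mathbb{Z}^m$ and $\mathcal{D}_B\subset\mathbb{Z}^n$ are finite sets with $\mathbf{0}_m\in\mathcal{D}_A$ and $\mathbf{0}_n\in\mathcal{D}_B$. Then $(A\oplus B,\mathcal{D}_A\oplus\mathcal{D}_B)$ is a digit system with the finiteness property in $\mathbb{Z}^{m+n}[A\oplus B]$ if and only if the digit systems $(A,\mathcal{D}_A)$ in $\mathbb{Z}^m[A]$ and $(B,\mathcal{D}_B)$ in $\mathbb{Z}^n[B]$ both have the finiteness property.
   Context: For $\mathbf{v}\in\mathbb{Q}^m$, $\mathbf{w}\in\mathbb{Q}^n$, the block sum is $\mathbf{v}\oplus\mathbf{w}:=(\mathbf{v},\mathbf{w})^T\in\mathbb{Q}^{m+n}$; for sets, $\mathcal{D}_A\oplus\mathcal{D}_B:=\{\mathbf{v}\oplus\mathbf{w}:\mathbf{v}\in\mathcal{D}_A,\mathbf{w}\in\mathcal{D}_B\}$. For $A\in M_m(\mathbb{Q})$, $B\in M_n(\mathbb{Q})$, $A\oplus B\in M_{m+n}(\mathbb{Q})$ is the block-diagonal matrix with diagonal blocks $A$ and $B$ and zero off-diagonal blocks. For $A\in M_k(\mathbb{Q})$, $\mathbb{Z}^k[A]:=\bigcup_{j\ge1}(\mathbb{Z}^k+A\mathbb{Z}^k+\dots+A^{j-1}\mathbb{Z}^k)$. For a finite $\mathcal{D}\subset\mathbb{Z}^k[A]$, $(A,\mathcal{D})$ is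 a digit system in $\mathbb{Z}^k[A]$, $\mathcal{D}[A]:=\{\mathbf{d}_0+A\mathbf{d}_1+\dots+A^j\mathbf{d}_j: j\ge0,\ \mathbf{d}_i\in\mathcal{D}\}$, and it has the finiteness property if $\mathcal{D}[A]=\mathbb{Z}^k[A]$. -}

module Defs where

open import Data.Nat using (ℕ; _+_)
open import Data.Integer using (ℤ)
open import Data.Rational using (ℚ; 0ℚ; _/_) renaming (_+_ to _+ℚ_; _*_ to _*ℚ_)
open import Data.Vec using (Vec; []; _∷_; map; zipWith; foldr; replicate; _++_)
open import Data.List using (List; []; _∷_; cartesianProductWith)
open import Data.List.Membership.Propositional using (_∈_)
open import Data.List.Relation.Unary.All using (All)
open import Data.Product using (Σ; _×_; ∃-syntax)
open import Relation.Binary.PropositionalEquality using (_≡_)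

Vecℚ : ℕ → Set
Vecℚ k = Vec ℚ k

Vecℤ : ℕ → Set
Vecℤ k = Vec ℤ k

Mat : ℕ → Set
Mat k = Vec (Vec ℚ k) k

ι : ∀ {k} → Vecℤ k → Vecℚ k
ι = map (λ z → z / 1)

_+ᵥ_ : ∀ {k} → Vecℚ k → Vecℚ k → Vecℚ k
_+ᵥ_ = zipWith _+ℚ_

_·_ : ∀ {k} → Mat k → Vecℚ k → Vecℚ k
M · v = map (λ row → foldr _ _+ℚ_ 0ℚ (zipWith _*ℚ_ row v)) M

_⊕ᵥ_ : ∀ {m n} {A : Set} → Vec A m → Vec A n → Vec A (m + n)
_⊕ᵥ_ = _++_

_⊕ₘ_ : ∀ {m n} → Mat m → Mat n → Mat (m + n)
_⊕ₘ_ {m} {n} A B =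
  map (λ r → r ++ replicate n 0ℚ) A ++ map (λ r → replicate m 0ℚ ++ r) B

_⊕ₛ_ : ∀ {m n} → List (Vecℤ m) → List (Vecℤ n) → List (Vecℤ (m + n))
DA ⊕ₛ DB = cartesianProductWith _⊕ᵥ_ DA DB

-- d₀ + A d₁ + … + A^j d_j  for a nonempty digit list d₀ ∷ (d₁ ∷ … ∷ d_j ∷ [])
horner : ∀ {k} → Mat k → Vecℤ k → List (Vecℤ k) → Vecℚ k
horner A d []       = ι d
horner A d (e ∷ es) = ι d +ᵥ (A · horner A e es)

-- ℤ^k[A] = ⋃_{j ≥ 1} (ℤ^k + A ℤ^k + … + A^{j-1} ℤ^k)
ℤ[_] : ∀ {k} → Mat k → Vecℚ k → Set
ℤ[ A ] x = ∃[ d ] ∃[ ds ] (x ≡ horner A d ds)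

_[_]ᴰ : ∀ {k} → List (Vecℤ k) → Mat k → Vecℚ k → Set
(D [ A ]ᴰ) x = ∃[ d ] ∃[ ds ] (d ∈ D × All (_∈ D) ds × x ≡ horner A d ds)

HasFiniteness : ∀ {k} → Mat k → List (Vecℤ k) → Set
HasFiniteness A D = (∀ x → (D [ A ]ᴰ) x → ℤ[ A ] x) × (∀ x → ℤ[ A ] x → (D [ A ]ᴰ) x)

{-# OPTIONS --safe #-}
module Submission where

-- Because A ⊕ B acts blockwise, the value of a digit string for A ⊕ B is the block sum of the
-- values of its upper and lower halves (horner-⊕ₘ), so every expansion for A ⊕ B splits into
-- expansions for A and for B. Conversely, expansions for A and for B of different lengths are
-- merged after padding the shorter one with zero digits; this is where 0 ∈ D_A and 0 ∈ D_B are
-- needed, and it works because a trailing zero digit does not change the value.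

open import Defs
open import Data.Nat using (ℕ) renaming (_+_ to _+ℕ_)
open import Data.Integer using (+_)
open import Data.Vec using (Vec; []; _∷_; replicate; _++_; zipWith; foldr; map; take; drop)
open import Data.List using (List; []; _∷_) renaming (map to lmap)
open import Data.List.Membership.Propositional using (_∈_)
open import Data.List.Membership.Propositional.Properties
  using (∈-cartesianProductWith⁺; ∈-cartesianProductWith⁻)
open import Data.List.Relation.Unary.All using (All; []; _∷_) renaming (map to All-map)
open import Data.List.Relation.Unary.All.Properties using (map⁺)
open import Data.Product using (_×_; _,_; proj₁; proj₂)
open import Data.Rational using (ℚ; 0ℚ) renaming (_+_ to _+ℚ_; _*_ to _*ℚ_)
open import Data.Rational.Properties using (+-identityˡ; +-identityʳ; +-assoc; *-zeroˡ; *-zeroʳ)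
open import Data.Vec.Properties
  using (take++drop≡id; ++-injectiveˡ; ++-injectiveʳ; map-++; map-∘; map-cong; map-const;
         map-replicate; zipWith-++; zipWith-identityʳ)
open import Function.Bundles using (_⇔_; mk⇔)
open import Relation.Binary.PropositionalEquality
  using (_≡_; refl; sym; trans; cong; cong₂; subst; module ≡-Reasoning)

private
  variable
    k m n : ℕ

dot : Vec ℚ k → Vec ℚ k → ℚ
dot r v = foldr _ _+ℚ_ 0ℚ (zipWith _*ℚ_ r v)

dot-zeroˡ : (v : Vec ℚ k) → dot (replicate k 0ℚ) v ≡ 0ℚ
dot-zeroˡ []      = refl
dot-zeroˡ (x ∷ v) = trans (cong₂ _+ℚ_ (*-zeroˡ x) (dot-zeroˡ v)) (+-identityˡ 0ℚ)

dot-zeroʳ : (r : Vec ℚ k) → dot r (replicate k 0ℚ) ≡ 0ℚ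
dot-zeroʳ []      = refl
dot-zeroʳ (x ∷ r) = trans (cong₂ _+ℚ_ (*-zeroʳ x) (dot-zeroʳ r)) (+-identityˡ 0ℚ)

dot-++ : (r u : Vec ℚ m) (r′ v : Vec ℚ n) → dot (r ++ r′) (u ++ v) ≡ dot r u +ℚ dot r′ v
dot-++ []      []      r′ v = sym (+-identityˡ (dot r′ v))
dot-++ (x ∷ r) (y ∷ u) r′ v =
  trans (cong (x *ℚ y +ℚ_) (dot-++ r u r′ v)) (sym (+-assoc (x *ℚ y) (dot r u) (dot r′ v)))

⊕ₘ-·-++ : (A : Mat m) (B : Mat n) (u : Vecℚ m) (v : Vecℚ n) →
          (A ⊕ₘ B) · (u ++ v) ≡ (A · u) ++ (B · v)
⊕ₘ-·-++ {m} {n} A B u v = begin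
  map (λ r → dot r (u ++ v)) (map padʳ A ++ map padˡ B)
    ≡⟨ map-++ _ (map padʳ A) (map padˡ B) ⟩
  map (λ r → dot r (u ++ v)) (map padʳ A) ++ map (λ r → dot r (u ++ v)) (map padˡ B)
    ≡⟨ cong₂ _++_ (sym (map-∘ _ padʳ A)) (sym (map-∘ _ padˡ B)) ⟩
  map (λ r → dot (padʳ r) (u ++ v)) A ++ map (λ r → dot (padˡ r) (u ++ v)) B
    ≡⟨ cong₂ _++_ (map-cong upper A) (map-cong lower B) ⟩
  (A · u) ++ (B · v) ∎
  where
  open ≡-Reasoning
  padʳ : Vec ℚ m → Vec ℚ (m +ℕ n)
  padʳ r = r ++ replicate n 0ℚ
  padˡ : Vec ℚ n → Vec ℚ (m +ℕ n)
  padˡ r = replicate m 0ℚ ++ r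
  upper : ∀ r → dot (padʳ r) (u ++ v) ≡ dot r u
  upper r = trans (dot-++ r u _ v) (trans (cong (dot r u +ℚ_) (dot-zeroˡ v)) (+-identityʳ _))
  lower : ∀ r → dot (padˡ r) (u ++ v) ≡ dot r v
  lower r = trans (dot-++ (replicate m 0ℚ) u r v)
                  (trans (cong (_+ℚ dot r v) (dot-zeroˡ u)) (+-identityˡ _))

·-zeroʳ : (M : Mat k) → M · replicate k 0ℚ ≡ replicate k 0ℚ
·-zeroʳ M = trans (map-cong dot-zeroʳ M) (map-const M 0ℚ)

take-++ : ∀ {a} {X : Set a} (xs : Vec X m) (ys : Vec X n) → take m (xs ++ ys) ≡ xs
take-++ {m} xs ys = ++-injectiveˡ _ _ (take++drop≡id m (xs ++ ys))

drop-++ : ∀ {a} {X : Set a} (xs : Vec X m) (ys : Vec X n) → drop m (xs ++ ys) ≡ ys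
drop-++ {m} xs ys = ++-injectiveʳ _ _ (take++drop≡id m (xs ++ ys))

ι-take-drop : ∀ m (d : Vecℤ (m +ℕ n)) → ι d ≡ ι (take m d) ++ ι (drop m d)
ι-take-drop m d = trans (cong ι (sym (take++drop≡id m d))) (map-++ _ (take m d) (drop m d))

horner-⊕ₘ : (A : Mat m) (B : Mat n) (d : Vecℤ (m +ℕ n)) (ds : List (Vecℤ (m +ℕ n))) →
            horner (A ⊕ₘ B) d ds ≡
            horner A (take m d) (lmap (take m) ds) ++ horner B (drop m d) (lmap (drop m) ds)
horner-⊕ₘ {m} A B d []       = ι-take-drop m d
horner-⊕ₘ {m} {n} A B d (e ∷ es) = begin
  ι d +ᵥ ((A ⊕ₘ B) · horner (A ⊕ₘ B) e es)
    ≡⟨ cong₂ (λ x y → x +ᵥ ((A ⊕ₘ B) · y)) (ι-take-drop m d) (horner-⊕ₘ A B e es) ⟩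
  (ι (take m d) ++ ι (drop m d)) +ᵥ ((A ⊕ₘ B) · (hA ++ hB))
    ≡⟨ cong (_ +ᵥ_) (⊕ₘ-·-++ A B hA hB) ⟩
  (ι (take m d) ++ ι (drop m d)) +ᵥ ((A · hA) ++ (B · hB))
    ≡⟨ zipWith-++ _+ℚ_ (ι (take m d)) (ι (drop m d)) (A · hA) (B · hB) ⟩
  (ι (take m d) +ᵥ (A · hA)) ++ (ι (drop m d) +ᵥ (B · hB)) ∎
  where
  open ≡-Reasoning
  hA : Vecℚ m
  hA = horner A (take m e) (lmap (take m) es)
  hB : Vecℚ n
  hB = horner B (drop m e) (lmap (drop m) es)

take-horner-⊕ₘ : (A : Mat m) (B : Mat n) (d : Vecℤ (m +ℕ n)) (ds : List (Vecℤ (m +ℕ n))) →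
                 take m (horner (A ⊕ₘ B) d ds) ≡ horner A (take m d) (lmap (take m) ds)
take-horner-⊕ₘ {m} A B d ds =
  trans (cong (take m) (horner-⊕ₘ A B d ds)) (take-++ (horner A (take m d) (lmap (take m) ds)) _)

drop-horner-⊕ₘ : (A : Mat m) (B : Mat n) (d : Vecℤ (m +ℕ n)) (ds : List (Vecℤ (m +ℕ n))) →
                 drop m (horner (A ⊕ₘ B) d ds) ≡ horner B (drop m d) (lmap (drop m) ds)
drop-horner-⊕ₘ {m} A B d ds =
  trans (cong (drop m) (horner-⊕ₘ A B d ds)) (drop-++ (horner A (take m d) (lmap (take m) ds)) _)

horner-zero-digit : (A : Mat k) (a : Vecℤ k) → horner A a (replicate k (+ 0) ∷ []) ≡ ι a
horner-zero-digit {k} A a = begin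
  ι a +ᵥ (A · ι (replicate k (+ 0))) ≡⟨ cong (λ z → ι a +ᵥ (A · z)) (map-replicate _ (+ 0) k) ⟩
  ι a +ᵥ (A · replicate k 0ℚ)        ≡⟨ cong (ι a +ᵥ_) (·-zeroʳ A) ⟩
  ι a +ᵥ replicate k 0ℚ              ≡⟨ zipWith-identityʳ +-identityʳ (ι a) ⟩
  ι a                                ∎
  where open ≡-Reasoning

zipPadded : List (Vecℤ m) → List (Vecℤ n) → List (Vecℤ (m +ℕ n))
zipPadded         []       []       = []
zipPadded {n = n} (x ∷ xs) []       = (x ++ replicate n (+ 0)) ∷ zipPadded xs []
zipPadded {m = m} []       (y ∷ ys) = (replicate m (+ 0) ++ y) ∷ zipPadded [] ys
zipPadded         (x ∷ xs) (y ∷ ys) = (x ++ y) ∷ zipPadded xs ys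

horner-∷-cong : (A : Mat k) (a : Vecℤ k) {h h′ : Vecℚ k} →
                   h ≡ h′ → ι a +ᵥ (A · h) ≡ ι a +ᵥ (A · h′)
horner-∷-cong A a = cong (λ h → ι a +ᵥ (A · h))

horner-take-zipPadded : (A : Mat m) (a : Vecℤ m) (xs : List (Vecℤ m)) (ys : List (Vecℤ n)) →
                        horner A a (lmap (take m) (zipPadded xs ys)) ≡ horner A a xs
horner-take-zipPadded A a [] [] = refl
horner-take-zipPadded {n = n} A a (x ∷ xs) [] rewrite take-++ x (replicate n (+ 0)) =
  horner-∷-cong A a (horner-take-zipPadded {n = n} A x xs [])
horner-take-zipPadded {m} A a [] (y ∷ ys) rewrite take-++ (replicate m (+ 0)) y =
  trans (horner-∷-cong A a (horner-take-zipPadded A (replicate m (+ 0)) [] ys))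
        (horner-zero-digit A a)
horner-take-zipPadded A a (x ∷ xs) (y ∷ ys) rewrite take-++ x y =
  horner-∷-cong A a (horner-take-zipPadded A x xs ys)

horner-drop-zipPadded : (B : Mat n) (b : Vecℤ n) (xs : List (Vecℤ m)) (ys : List (Vecℤ n)) →
                        horner B b (lmap (drop m) (zipPadded xs ys)) ≡ horner B b ys
horner-drop-zipPadded B b [] [] = refl
horner-drop-zipPadded {n} B b (x ∷ xs) [] rewrite drop-++ x (replicate n (+ 0)) =
  trans (horner-∷-cong B b (horner-drop-zipPadded B (replicate n (+ 0)) xs []))
        (horner-zero-digit B b)
horner-drop-zipPadded {m = m} B b [] (y ∷ ys) rewrite drop-++ (replicate m (+ 0)) y =
  horner-∷-cong B b (horner-drop-zipPadded {m = m} B y [] ys)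
horner-drop-zipPadded B b (x ∷ xs) (y ∷ ys) rewrite drop-++ x y =
  horner-∷-cong B b (horner-drop-zipPadded B y xs ys)

horner-⊕ₘ-zipPadded : (A : Mat m) (B : Mat n) (a : Vecℤ m) (b : Vecℤ n)
                      (xs : List (Vecℤ m)) (ys : List (Vecℤ n)) →
                      horner (A ⊕ₘ B) (a ++ b) (zipPadded xs ys) ≡ horner A a xs ++ horner B b ys
horner-⊕ₘ-zipPadded {m} {n} A B a b xs ys = begin
  horner (A ⊕ₘ B) (a ++ b) (zipPadded xs ys)
    ≡⟨ horner-⊕ₘ A B (a ++ b) (zipPadded xs ys) ⟩
  horner A (take m (a ++ b)) tops ++ horner B (drop m (a ++ b)) bottoms
    ≡⟨ cong₂ (λ a′ b′ → horner A a′ tops ++ horner B b′ bottoms) (take-++ a b) (drop-++ a b) ⟩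
  horner A a tops ++ horner B b bottoms
    ≡⟨ cong₂ _++_ (horner-take-zipPadded A a xs ys) (horner-drop-zipPadded B b xs ys) ⟩
  horner A a xs ++ horner B b ys ∎
  where
  open ≡-Reasoning
  tops : List (Vecℤ m)
  tops = lmap (take m) (zipPadded xs ys)
  bottoms : List (Vecℤ n)
  bottoms = lmap (drop m) (zipPadded xs ys)

ᴰ⊆ℤ : (A : Mat k) (D : List (Vecℤ k)) → ∀ x → (D [ A ]ᴰ) x → ℤ[ A ] x
ᴰ⊆ℤ A D x (d , ds , _ , _ , x≡) = d , ds , x≡

module _ (A : Mat m) (B : Mat n) where

  ℤ[⊕ₘ]-split : ∀ x → ℤ[ A ⊕ₘ B ] x → ℤ[ A ] (take m x) × ℤ[ B ] (drop m x)
  ℤ[⊕ₘ]-split x (d , ds , x≡) =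
    (take m d , lmap (take m) ds , trans (cong (take m) x≡) (take-horner-⊕ₘ A B d ds)) ,
    (drop m d , lmap (drop m) ds , trans (cong (drop m) x≡) (drop-horner-⊕ₘ A B d ds))

  ℤ[⊕ₘ]-join : ∀ u v → ℤ[ A ] u → ℤ[ B ] v → ℤ[ A ⊕ₘ B ] (u ++ v)
  ℤ[⊕ₘ]-join u v (a , as , u≡) (b , bs , v≡) =
    a ++ b , zipPadded as bs , trans (cong₂ _++_ u≡ v≡) (sym (horner-⊕ₘ-zipPadded A B a b as bs))

  module _ (DA : List (Vecℤ m)) (DB : List (Vecℤ n)) where

    take-∈-⊕ₛ : ∀ {e} → e ∈ DA ⊕ₛ DB → take m e ∈ DA
    take-∈-⊕ₛ e∈ with ∈-cartesianProductWith⁻ _++_ DA DB e∈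
    ... | a , b , a∈ , _ , refl = subst (_∈ DA) (sym (take-++ a b)) a∈

    drop-∈-⊕ₛ : ∀ {e} → e ∈ DA ⊕ₛ DB → drop m e ∈ DB
    drop-∈-⊕ₛ e∈ with ∈-cartesianProductWith⁻ _++_ DA DB e∈
    ... | a , b , _ , b∈ , refl = subst (_∈ DB) (sym (drop-++ a b)) b∈

    ᴰ[⊕ₘ]-split : ∀ x → ((DA ⊕ₛ DB) [ A ⊕ₘ B ]ᴰ) x →
                  (DA [ A ]ᴰ) (take m x) × (DB [ B ]ᴰ) (drop m x)
    ᴰ[⊕ₘ]-split x (e , es , e∈ , es∈ , x≡) =
      (take m e , lmap (take m) es , take-∈-⊕ₛ e∈ , map⁺ (All-map take-∈-⊕ₛ es∈) ,
       trans (cong (take m) x≡) (take-horner-⊕ₘ A B e es)) ,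
      (drop m e , lmap (drop m) es , drop-∈-⊕ₛ e∈ , map⁺ (All-map drop-∈-⊕ₛ es∈) ,
       trans (cong (drop m) x≡) (drop-horner-⊕ₘ A B e es))

    module _ (0∈DA : replicate m (+ 0) ∈ DA) (0∈DB : replicate n (+ 0) ∈ DB) where

      zipPadded-∈ : ∀ {xs ys} → All (_∈ DA) xs → All (_∈ DB) ys →
                    All (_∈ DA ⊕ₛ DB) (zipPadded xs ys)
      zipPadded-∈ []         []         = []
      zipPadded-∈ (x∈ ∷ xs∈) []         = ∈-cartesianProductWith⁺ _++_ x∈ 0∈DB ∷ zipPadded-∈ xs∈ []
      zipPadded-∈ []         (y∈ ∷ ys∈) = ∈-cartesianProductWith⁺ _++_ 0∈DA y∈ ∷ zipPadded-∈ [] ys∈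
      zipPadded-∈ (x∈ ∷ xs∈) (y∈ ∷ ys∈) = ∈-cartesianProductWith⁺ _++_ x∈ y∈ ∷ zipPadded-∈ xs∈ ys∈

      ᴰ[⊕ₘ]-join : ∀ u v → (DA [ A ]ᴰ) u → (DB [ B ]ᴰ) v → ((DA ⊕ₛ DB) [ A ⊕ₘ B ]ᴰ) (u ++ v)
      ᴰ[⊕ₘ]-join u v (a , as , a∈ , as∈ , u≡) (b , bs , b∈ , bs∈ , v≡) =
        a ++ b , zipPadded as bs , ∈-cartesianProductWith⁺ _++_ a∈ b∈ , zipPadded-∈ as∈ bs∈ ,
        trans (cong₂ _++_ u≡ v≡) (sym (horner-⊕ₘ-zipPadded A B a b as bs))

proposition2 : ∀ {m n} (A : Mat m) (B : Mat n)
    (DA : List (Vecℤ m)) (DB : List (Vecℤ n)) →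
    replicate m (+ 0) ∈ DA → replicate n (+ 0) ∈ DB →
    HasFiniteness (A ⊕ₘ B) (DA ⊕ₛ DB) ⇔ (HasFiniteness A DA × HasFiniteness B DB)
proposition2 {m} {n} A B DA DB 0∈DA 0∈DB = mk⇔ factors blockSum
  where
  factors : HasFiniteness (A ⊕ₘ B) (DA ⊕ₛ DB) → HasFiniteness A DA × HasFiniteness B DB
  factors (_ , ℤ⊆ᴰ) = (ᴰ⊆ℤ A DA , ℤ⊆ᴰA) , (ᴰ⊆ℤ B DB , ℤ⊆ᴰB)
    where
    0ᴬ : ℤ[ A ] (ι (replicate m (+ 0)))
    0ᴬ = replicate m (+ 0) , [] , refl
    0ᴮ : ℤ[ B ] (ι (replicate n (+ 0)))
    0ᴮ = replicate n (+ 0) , [] , refl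
    ℤ⊆ᴰA : ∀ u → ℤ[ A ] u → (DA [ A ]ᴰ) u
    ℤ⊆ᴰA u uℤ = subst (DA [ A ]ᴰ) (take-++ u _)
      (proj₁ (ᴰ[⊕ₘ]-split A B DA DB _ (ℤ⊆ᴰ _ (ℤ[⊕ₘ]-join A B u _ uℤ 0ᴮ))))
    ℤ⊆ᴰB : ∀ v → ℤ[ B ] v → (DB [ B ]ᴰ) v
    ℤ⊆ᴰB v vℤ = subst (DB [ B ]ᴰ) (drop-++ (ι (replicate m (+ 0))) v)
      (proj₂ (ᴰ[⊕ₘ]-split A B DA DB _ (ℤ⊆ᴰ _ (ℤ[⊕ₘ]-join A B _ v 0ᴬ vℤ))))

  blockSum : HasFiniteness A DA × HasFiniteness B DB → HasFiniteness (A ⊕ₘ B) (DA ⊕ₛ DB)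
  blockSum ((_ , ℤ⊆ᴰA) , (_ , ℤ⊆ᴰB)) = ᴰ⊆ℤ (A ⊕ₘ B) (DA ⊕ₛ DB) , ℤ⊆ᴰ
    where
    ℤ⊆ᴰ : ∀ x → ℤ[ A ⊕ₘ B ] x → ((DA ⊕ₛ DB) [ A ⊕ₘ B ]ᴰ) x
    ℤ⊆ᴰ x xℤ = subst ((DA ⊕ₛ DB) [ A ⊕ₘ B ]ᴰ) (take++drop≡id m x)
      (ᴰ[⊕ₘ]-join A B DA DB 0∈DA 0∈DB _ _ (ℤ⊆ᴰA _ (proj₁ (ℤ[⊕ₘ]-split A B x xℤ)))
                                          (ℤ⊆ᴰB _ (proj₂ (ℤ[⊕ₘ]-split A B x xℤ))))
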